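{- Let $n$ be even and let $A$ be the hyperbolic unimodular symmetric bilinear form over $\mathbb{F}_2$ of dimension $n$, i.e. $A=P^tJP$ for some $P\in\mathrm{GL}_n(\mathbb{F}_2)$, where $J$ is the $n\times n$ matrix with $1$'s on the anti-diagonal and $0$ elsewhere. Then for every symmetric $n\times n$ matrix $B$ over $\mathbb{F}_2$, the resolvent polynomial $\det(Ax-B)$ lies in $\mathbb{F}_2[x^2]=(\mathbb{F}_2[x])^2$. Furthermore, the same holds with $\mathbb{F}_2$ replaced by any commutative ring $T$ of characteristic $2$ (with $A$ hyperbolic over $T$ and $B$ symmetric over $T$): $\det(Ax-B)\in T[x^2]$.
   Context: Over a ring of characteristic $2$, the resolvent of the pair $(A,B)$ of symmetric matrices is $\pm\det(Ax-B)$, signs being irrelevant. -}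

module Defs where

open import Level using (Level)
open import Data.Nat using (ℕ; zero; suc; _∸_) renaming (_+_ to _+ℕ_)
open import Data.Product using (Σ; _×_)
open import Relation.Nullary using (¬_)
open import Data.Nat.Properties using (_≟_)
open import Data.Fin using (Fin; zero; suc; toℕ; punchIn)
import Data.Fin as F
open import Data.List using (List; []; _∷_; map)
open import Data.Bool using (if_then_else_)
open import Relation.Nullary.Decidable using (⌊_⌋)
open import Algebra.Bundles using (CommutativeRing)

module RawOps {a : Level} {C : Set a}
  (_⊕_ _⊗_ : C → C → C) (⊖_ : C → C) (𝟘 𝟙 : C) where

  sumFin : ∀ {n} → (Fin n → C) → C
  sumFin {zero}  f = 𝟘
  sumFin {suc n} f = f zero ⊕ sumFin (λ i → f (suc i))

  signed : ℕ → C → C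
  signed zero    x = x
  signed (suc k) x = ⊖ (signed k x)

  det : ∀ {n} → (Fin n → Fin n → C) → C
  det {zero}  M = 𝟙
  det {suc n} M = sumFin (λ j →
    signed (toℕ j) (M zero j ⊗ det (λ r c → M (suc r) (punchIn j c))))

module _ {c ℓ : Level} (R : CommutativeRing c ℓ) where
  open CommutativeRing R

  Matrix : ℕ → Set c
  Matrix n = Fin n → Fin n → Carrier

  open RawOps _+_ _*_ -_ 0# 1# using (sumFin) renaming (det to detR)

  _⊠_ : ∀ {n} → Matrix n → Matrix n → Matrix n
  (M ⊠ N) i j = sumFin (λ k → M i k * N k j)

  transpose : ∀ {n} → Matrix n → Matrix n
  transpose M i j = M j i

  identity : ∀ {n} → Matrix n
  identity i j = if ⌊ i F.≟ j ⌋ then 1# else 0#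

  antiDiag : ∀ {n} → Matrix n
  antiDiag {n} i j = if ⌊ toℕ i +ℕ toℕ j ≟ n ∸ 1 ⌋ then 1# else 0#

  _≈ₘ_ : ∀ {n} → Matrix n → Matrix n → Set ℓ
  M ≈ₘ N = ∀ i j → M i j ≈ N i j

  Symmetric : ∀ {n} → Matrix n → Set ℓ
  Symmetric M = ∀ i j → M i j ≈ M j i

  Invertible : ∀ {n} → Matrix n → Set (c Level.⊔ ℓ)
  Invertible {n} P = Σ (Matrix n) (λ Q → ((P ⊠ Q) ≈ₘ identity) × ((Q ⊠ P) ≈ₘ identity))

  Hyperbolic : ∀ {n} → Matrix n → Set (c Level.⊔ ℓ)
  Hyperbolic {n} A = Σ (Matrix n) (λ P → Invertible P × (A ≈ₘ ((transpose P ⊠ antiDiag) ⊠ P)))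

  Char2 : Set ℓ
  Char2 = ((1# + 1#) ≈ 0#) × ¬ (1# ≈ 0#)

  -- Polynomials in x over R: coefficient lists, constant term first
  Poly : Set c
  Poly = List Carrier

  _+ₚ_ : Poly → Poly → Poly
  []      +ₚ q       = q
  (a ∷ p) +ₚ []      = a ∷ p
  (a ∷ p) +ₚ (b ∷ q) = (a + b) ∷ (p +ₚ q)

  _*ₚ_ : Poly → Poly → Poly
  []      *ₚ q = []
  (a ∷ p) *ₚ q = map (a *_) q +ₚ (0# ∷ (p *ₚ q))

  -ₚ_ : Poly → Poly
  -ₚ p = map (-_) p

  coeff : Poly → ℕ → Carrier
  coeff []      k       = 0#
  coeff (a ∷ p) zero    = a
  coeff (a ∷ p) (suc k) = coeff p k

  detₚ : ∀ {n} → (Fin n → Fin n → Poly) → Poly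
  detₚ = RawOps.det _+ₚ_ _*ₚ_ -ₚ_ [] (1# ∷ [])

  resolvent : ∀ {n} → Matrix n → Matrix n → Poly
  resolvent A B = detₚ (λ i j → (- B i j) ∷ A i j ∷ [])

  InEvenPowers : Poly → Set ℓ
  InEvenPowers p = ∀ k → coeff p (suc (k +ℕ k)) ≈ 0#

{-# OPTIONS --safe #-}
module Submission where

-- In characteristic 2 the signs of the Laplace expansion disappear, and expanding a symmetric
-- matrix M along its first row and then every minor along its first column gives
--   det M = M₀₀ · det M⁽⁰⁰⁾ + Σᵢ M₀ᵢ² · det M⁽⁰ⁱ,⁰ⁱ⁾,
-- because the cross terms M₀ⱼ Mᵢ₀ det M⁽⁰ⁱ,⁰ʲ⁾ and M₀ᵢ Mⱼ₀ det M⁽⁰ʲ,⁰ⁱ⁾ are equal and cancel.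
-- By induction, det M lies in every subset S closed under +, · and containing all squares,
-- once the diagonal of M does. Take S = T[x²], which contains all squares since squaring is
-- additive in characteristic 2, and M = Ax − B: it is symmetric, and its diagonal entries
-- −Bᵢᵢ + Aᵢᵢx are constants because A = PᵗJP is alternating (J is alternating for even n,
-- and in characteristic 2 congruence preserves alternating matrices).

open import Defs
open import Level using (Level)
open import Data.Nat using (ℕ)
open import Data.Nat.Divisibility using (_∣_)
open import Algebra.Bundles using (CommutativeRing)

open import Data.Nat using (zero; suc; _≟_) renaming (_+_ to _+ℕ_)
import Data.Nat.Properties as ℕ
open import Data.Nat.Divisibility using (m∣m*n; ∣m+n∣m⇒∣n; ∣1⇒≡1)
open import Data.Fin using (Fin; zero; suc; toℕ; punchIn)
open import Data.List using ([]; _∷_; map)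
open import Data.Product using (_×_; _,_)
open import Relation.Nullary using (¬_; yes; no; contradiction)
open import Relation.Unary using (Pred)
open import Relation.Binary.Bundles using (Setoid)
open import Relation.Binary.Definitions using (_Respects_)
open import Relation.Binary.Structures using (IsEquivalence)
import Relation.Binary.PropositionalEquality as ≡
import Relation.Binary.Reasoning.Setoid as SetoidReasoning
import Algebra.Properties.CommutativeSemigroup as CommutativeSemigroupProperties

2∤1+n+n : ∀ n → ¬ 2 ∣ suc (n +ℕ n)
2∤1+n+n n 2∣odd = contradiction (∣1⇒≡1 (∣m+n∣m⇒∣n 2∣n+n+1 2∣n+n)) λ ()
  where
  2∣n+n+1 : 2 ∣ (n +ℕ n) +ℕ 1
  2∣n+n+1 = ≡.subst (2 ∣_) (ℕ.+-comm 1 (n +ℕ n)) 2∣odd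
  2∣n+n : 2 ∣ n +ℕ n
  2∣n+n = ≡.subst (2 ∣_) (≡.cong (n +ℕ_) (ℕ.+-identityʳ n)) (m∣m*n n)

module Polynomials {c ℓ : Level} (R : CommutativeRing c ℓ) where
  open CommutativeRing R hiding (zero)
  open import Algebra.Properties.Ring ring using (-0#≈0#)
  open CommutativeSemigroupProperties +-commutativeSemigroup using (interchange)

  infixl 6 _⊕_
  infixl 7 _⊗_
  infix  8 ⊖_
  infix  4 _≈ₚ_

  _⊕_ _⊗_ : Poly R → Poly R → Poly R
  _⊕_ = _+ₚ_ R
  _⊗_ = _*ₚ_ R

  ⊖_ : Poly R → Poly R
  ⊖_ = -ₚ_ R

  1ₚ : Poly R
  1ₚ = 1# ∷ []

  -- (a ∷ p) ⊗ q unfolds to scale a q ⊕ shift (p ⊗ q).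
  scale : Carrier → Poly R → Poly R
  scale a = map (a *_)

  shift : Poly R → Poly R
  shift p = 0# ∷ p

  record _≈ₚ_ (p q : Poly R) : Set ℓ where
    constructor coeffwise
    field coeff-≈ : ∀ k → coeff R p k ≈ coeff R q k
  open _≈ₚ_ public

  ≈ₚ-isEquivalence : IsEquivalence _≈ₚ_
  ≈ₚ-isEquivalence = record
    { refl  = coeffwise λ _ → refl
    ; sym   = λ p≈q → coeffwise λ k → sym (coeff-≈ p≈q k)
    ; trans = λ p≈q q≈r → coeffwise λ k → trans (coeff-≈ p≈q k) (coeff-≈ q≈r k)
    }

  ≈ₚ-setoid : Setoid c ℓ
  ≈ₚ-setoid = record { isEquivalence = ≈ₚ-isEquivalence }

  open Setoid ≈ₚ-setoid public using ()
    renaming (refl to ≈ₚ-refl; sym to ≈ₚ-sym; trans to ≈ₚ-trans)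

  ∷-cong : ∀ {a b p q} → a ≈ b → p ≈ₚ q → a ∷ p ≈ₚ b ∷ q
  ∷-cong a≈b p≈q = coeffwise λ { zero → a≈b ; (suc k) → coeff-≈ p≈q k }

  coeff-⊕ : ∀ p q k → coeff R (p ⊕ q) k ≈ coeff R p k + coeff R q k
  coeff-⊕ []      q       k       = sym (+-identityˡ _)
  coeff-⊕ (a ∷ p) []      k       = sym (+-identityʳ _)
  coeff-⊕ (a ∷ p) (b ∷ q) zero    = refl
  coeff-⊕ (a ∷ p) (b ∷ q) (suc k) = coeff-⊕ p q k

  coeff-scale : ∀ a p k → coeff R (scale a p) k ≈ a * coeff R p k
  coeff-scale a []      k       = sym (zeroʳ a)
  coeff-scale a (b ∷ p) zero    = refl
  coeff-scale a (b ∷ p) (suc k) = coeff-scale a p k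

  coeff-⊖ : ∀ p k → coeff R (⊖ p) k ≈ - coeff R p k
  coeff-⊖ []      k       = sym -0#≈0#
  coeff-⊖ (a ∷ p) zero    = refl
  coeff-⊖ (a ∷ p) (suc k) = coeff-⊖ p k

  coeffwise-⊕ : ∀ p q r s → (∀ k → coeff R p k + coeff R q k ≈ coeff R r k + coeff R s k) →
                p ⊕ q ≈ₚ r ⊕ s
  coeffwise-⊕ p q r s eq =
    coeffwise λ k → trans (coeff-⊕ p q k) (trans (eq k) (sym (coeff-⊕ r s k)))

  ⊕-cong : ∀ {p p′ q q′} → p ≈ₚ p′ → q ≈ₚ q′ → p ⊕ q ≈ₚ p′ ⊕ q′
  ⊕-cong {p} {p′} {q} {q′} p≈p′ q≈q′ = coeffwise-⊕ p q p′ q′ λ k → +-cong (coeff-≈ p≈p′ k) (coeff-≈ q≈q′ k)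

  ⊕-assoc : ∀ p q r → (p ⊕ q) ⊕ r ≈ₚ p ⊕ (q ⊕ r)
  ⊕-assoc p q r = coeffwise-⊕ (p ⊕ q) r p (q ⊕ r) λ k →
    trans (+-congʳ (coeff-⊕ p q k)) (trans (+-assoc _ _ _) (+-congˡ (sym (coeff-⊕ q r k))))

  ⊕-comm : ∀ p q → p ⊕ q ≈ₚ q ⊕ p
  ⊕-comm p q = coeffwise-⊕ p q q p λ _ → +-comm _ _

  ⊕-interchange : ∀ p q r s → (p ⊕ q) ⊕ (r ⊕ s) ≈ₚ (p ⊕ r) ⊕ (q ⊕ s)
  ⊕-interchange p q r s = coeffwise-⊕ (p ⊕ q) (r ⊕ s) (p ⊕ r) (q ⊕ s) λ k → begin
    coeff R (p ⊕ q) k + coeff R (r ⊕ s) k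
      ≈⟨ +-cong (coeff-⊕ p q k) (coeff-⊕ r s k) ⟩
    (coeff R p k + coeff R q k) + (coeff R r k + coeff R s k)
      ≈⟨ interchange _ _ _ _ ⟩
    (coeff R p k + coeff R r k) + (coeff R q k + coeff R s k)
      ≈⟨ +-cong (coeff-⊕ p r k) (coeff-⊕ q s k) ⟨
    coeff R (p ⊕ r) k + coeff R (q ⊕ s) k ∎
    where open SetoidReasoning setoid

  ⊕-identityʳ : ∀ p → p ⊕ [] ≈ₚ p
  ⊕-identityʳ p = coeffwise λ k → trans (coeff-⊕ p [] k) (+-identityʳ _)

  ⊕-inverseˡ : ∀ p → ⊖ p ⊕ p ≈ₚ []
  ⊕-inverseˡ p = coeffwise λ k →
    trans (coeff-⊕ (⊖ p) p k) (trans (+-congʳ (coeff-⊖ p k)) (-‿inverseˡ _))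

  ⊕-inverseʳ : ∀ p → p ⊕ ⊖ p ≈ₚ []
  ⊕-inverseʳ p = coeffwise λ k →
    trans (coeff-⊕ p (⊖ p) k) (trans (+-congˡ (coeff-⊖ p k)) (-‿inverseʳ _))

  ⊖-cong : ∀ {p q} → p ≈ₚ q → ⊖ p ≈ₚ ⊖ q
  ⊖-cong {p} {q} p≈q = coeffwise λ k →
    trans (coeff-⊖ p k) (trans (-‿cong (coeff-≈ p≈q k)) (sym (coeff-⊖ q k)))

  scale-cong : ∀ {a b p q} → a ≈ b → p ≈ₚ q → scale a p ≈ₚ scale b q
  scale-cong {a} {b} {p} {q} a≈b p≈q = coeffwise λ k →
    trans (coeff-scale a p k) (trans (*-cong a≈b (coeff-≈ p≈q k)) (sym (coeff-scale b q k)))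

  scale-⊕ : ∀ a p q → scale a (p ⊕ q) ≈ₚ scale a p ⊕ scale a q
  scale-⊕ a p q = coeffwise λ k → begin
    coeff R (scale a (p ⊕ q)) k                 ≈⟨ coeff-scale a (p ⊕ q) k ⟩
    a * coeff R (p ⊕ q) k                       ≈⟨ *-congˡ (coeff-⊕ p q k) ⟩
    a * (coeff R p k + coeff R q k)             ≈⟨ distribˡ a _ _ ⟩
    a * coeff R p k + a * coeff R q k           ≈⟨ +-cong (coeff-scale a p k) (coeff-scale a q k) ⟨
    coeff R (scale a p) k + coeff R (scale a q) k ≈⟨ coeff-⊕ (scale a p) (scale a q) k ⟨
    coeff R (scale a p ⊕ scale a q) k           ∎
    where open SetoidReasoning setoid

  scale-* : ∀ a b p → scale (a * b) p ≈ₚ scale a (scale b p)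
  scale-* a b p = coeffwise λ k → trans (coeff-scale (a * b) p k)
    (trans (*-assoc a b _) (sym (trans (coeff-scale a (scale b p) k) (*-congˡ (coeff-scale b p k)))))

  scale-0# : ∀ p → scale 0# p ≈ₚ []
  scale-0# p = coeffwise λ k → trans (coeff-scale 0# p k) (zeroˡ _)

  scale-1# : ∀ p → scale 1# p ≈ₚ p
  scale-1# p = coeffwise λ k → trans (coeff-scale 1# p k) (*-identityˡ _)

  shift-cong : ∀ {p q} → p ≈ₚ q → shift p ≈ₚ shift q
  shift-cong = ∷-cong refl

  shift-⊕ : ∀ p q → shift (p ⊕ q) ≈ₚ shift p ⊕ shift q
  shift-⊕ p q = ∷-cong (sym (+-identityʳ 0#)) ≈ₚ-refl

  shift-[] : shift [] ≈ₚ []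
  shift-[] = coeffwise λ { zero → refl ; (suc k) → refl }

  scale-shift : ∀ a p → scale a (shift p) ≈ₚ shift (scale a p)
  scale-shift a p = ∷-cong (zeroʳ a) ≈ₚ-refl

  ∷-split : ∀ a p → a ∷ p ≈ₚ (a ∷ []) ⊕ shift p
  ∷-split a p = ∷-cong (sym (+-identityʳ a)) ≈ₚ-refl

  ⊗-congʳ : ∀ p {q q′} → q ≈ₚ q′ → p ⊗ q ≈ₚ p ⊗ q′
  ⊗-congʳ []      q≈q′ = ≈ₚ-refl
  ⊗-congʳ (a ∷ p) q≈q′ = ⊕-cong (scale-cong refl q≈q′) (shift-cong (⊗-congʳ p q≈q′))

  ⊗-zeroʳ : ∀ p → p ⊗ [] ≈ₚ []
  ⊗-zeroʳ []      = ≈ₚ-refl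
  ⊗-zeroʳ (a ∷ p) = ≈ₚ-trans (shift-cong (⊗-zeroʳ p)) shift-[]

  ⊗-distribˡ : ∀ p q r → p ⊗ (q ⊕ r) ≈ₚ p ⊗ q ⊕ p ⊗ r
  ⊗-distribˡ []      q r = ≈ₚ-refl
  ⊗-distribˡ (a ∷ p) q r = begin
    scale a (q ⊕ r) ⊕ shift (p ⊗ (q ⊕ r))
      ≈⟨ ⊕-cong (scale-⊕ a q r) (≈ₚ-trans (shift-cong (⊗-distribˡ p q r)) (shift-⊕ (p ⊗ q) (p ⊗ r))) ⟩
    (scale a q ⊕ scale a r) ⊕ (shift (p ⊗ q) ⊕ shift (p ⊗ r))
      ≈⟨ ⊕-interchange (scale a q) (scale a r) (shift (p ⊗ q)) (shift (p ⊗ r)) ⟩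
    (scale a q ⊕ shift (p ⊗ q)) ⊕ (scale a r ⊕ shift (p ⊗ r)) ∎
    where open SetoidReasoning ≈ₚ-setoid

  ⊗-constʳ : ∀ p b → p ⊗ (b ∷ []) ≈ₚ scale b p
  ⊗-constʳ []      b = ≈ₚ-refl
  ⊗-constʳ (a ∷ p) b = begin
    (a * b ∷ []) ⊕ shift (p ⊗ (b ∷ [])) ≈⟨ ⊕-cong (∷-cong (*-comm a b) ≈ₚ-refl) (shift-cong (⊗-constʳ p b)) ⟩
    (b * a ∷ []) ⊕ shift (scale b p)    ≈⟨ ∷-split (b * a) (scale b p) ⟨
    scale b (a ∷ p)                     ∎
    where open SetoidReasoning ≈ₚ-setoid

  ⊗-shiftʳ : ∀ p q → p ⊗ shift q ≈ₚ shift (p ⊗ q)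
  ⊗-shiftʳ []      q = ≈ₚ-sym shift-[]
  ⊗-shiftʳ (a ∷ p) q = begin
    scale a (shift q) ⊕ shift (p ⊗ shift q)     ≈⟨ ⊕-cong (scale-shift a q) (shift-cong (⊗-shiftʳ p q)) ⟩
    shift (scale a q) ⊕ shift (shift (p ⊗ q))   ≈⟨ shift-⊕ (scale a q) (shift (p ⊗ q)) ⟨
    shift (scale a q ⊕ shift (p ⊗ q))           ∎
    where open SetoidReasoning ≈ₚ-setoid

  ⊗-consʳ : ∀ p b q → p ⊗ (b ∷ q) ≈ₚ scale b p ⊕ shift (p ⊗ q)
  ⊗-consʳ p b q = begin
    p ⊗ (b ∷ q)                    ≈⟨ ⊗-congʳ p (∷-split b q) ⟩
    p ⊗ ((b ∷ []) ⊕ shift q)       ≈⟨ ⊗-distribˡ p (b ∷ []) (shift q) ⟩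
    p ⊗ (b ∷ []) ⊕ p ⊗ shift q     ≈⟨ ⊕-cong (⊗-constʳ p b) (⊗-shiftʳ p q) ⟩
    scale b p ⊕ shift (p ⊗ q)      ∎
    where open SetoidReasoning ≈ₚ-setoid

  ⊗-comm : ∀ p q → p ⊗ q ≈ₚ q ⊗ p
  ⊗-comm []      q = ≈ₚ-sym (⊗-zeroʳ q)
  ⊗-comm (a ∷ p) q =
    ≈ₚ-trans (⊕-cong ≈ₚ-refl (shift-cong (⊗-comm p q))) (≈ₚ-sym (⊗-consʳ q a p))

  ⊗-congˡ : ∀ {p p′} q → p ≈ₚ p′ → p ⊗ q ≈ₚ p′ ⊗ q
  ⊗-congˡ {p} {p′} q p≈p′ =
    ≈ₚ-trans (⊗-comm p q) (≈ₚ-trans (⊗-congʳ q p≈p′) (⊗-comm q p′))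

  ⊗-distribʳ : ∀ p q r → (q ⊕ r) ⊗ p ≈ₚ q ⊗ p ⊕ r ⊗ p
  ⊗-distribʳ p q r = begin
    (q ⊕ r) ⊗ p     ≈⟨ ⊗-comm (q ⊕ r) p ⟩
    p ⊗ (q ⊕ r)     ≈⟨ ⊗-distribˡ p q r ⟩
    p ⊗ q ⊕ p ⊗ r   ≈⟨ ⊕-cong (⊗-comm p q) (⊗-comm p r) ⟩
    q ⊗ p ⊕ r ⊗ p   ∎
    where open SetoidReasoning ≈ₚ-setoid

  scale-⊗ : ∀ a p q → scale a p ⊗ q ≈ₚ scale a (p ⊗ q)
  scale-⊗ a []      q = ≈ₚ-refl
  scale-⊗ a (b ∷ p) q = begin
    scale (a * b) q ⊕ shift (scale a p ⊗ q)     ≈⟨ ⊕-cong (scale-* a b q) (shift-cong (scale-⊗ a p q)) ⟩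
    scale a (scale b q) ⊕ shift (scale a (p ⊗ q)) ≈⟨ ⊕-cong ≈ₚ-refl (scale-shift a (p ⊗ q)) ⟨
    scale a (scale b q) ⊕ scale a (shift (p ⊗ q)) ≈⟨ scale-⊕ a (scale b q) (shift (p ⊗ q)) ⟨
    scale a (scale b q ⊕ shift (p ⊗ q))          ∎
    where open SetoidReasoning ≈ₚ-setoid

  shift-⊗ : ∀ p q → shift p ⊗ q ≈ₚ shift (p ⊗ q)
  shift-⊗ p q = ⊕-cong (scale-0# q) ≈ₚ-refl

  ⊗-assoc : ∀ p q r → (p ⊗ q) ⊗ r ≈ₚ p ⊗ (q ⊗ r)
  ⊗-assoc []      q r = ≈ₚ-refl
  ⊗-assoc (a ∷ p) q r = begin
    (scale a q ⊕ shift (p ⊗ q)) ⊗ r         ≈⟨ ⊗-distribʳ r (scale a q) (shift (p ⊗ q)) ⟩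
    scale a q ⊗ r ⊕ shift (p ⊗ q) ⊗ r       ≈⟨ ⊕-cong (scale-⊗ a q r) (shift-⊗ (p ⊗ q) r) ⟩
    scale a (q ⊗ r) ⊕ shift ((p ⊗ q) ⊗ r)   ≈⟨ ⊕-cong ≈ₚ-refl (shift-cong (⊗-assoc p q r)) ⟩
    scale a (q ⊗ r) ⊕ shift (p ⊗ (q ⊗ r))   ∎
    where open SetoidReasoning ≈ₚ-setoid

  ⊗-identityˡ : ∀ p → 1ₚ ⊗ p ≈ₚ p
  ⊗-identityˡ p = ≈ₚ-trans (⊕-cong (scale-1# p) shift-[]) (⊕-identityʳ p)

  ⊗-identityʳ : ∀ p → p ⊗ 1ₚ ≈ₚ p
  ⊗-identityʳ p = ≈ₚ-trans (⊗-comm p 1ₚ) (⊗-identityˡ p)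

  polynomialRing : CommutativeRing c ℓ
  polynomialRing = record
    { Carrier = Poly R ; _≈_ = _≈ₚ_ ; _+_ = _⊕_ ; _*_ = _⊗_ ; -_ = ⊖_ ; 0# = [] ; 1# = 1ₚ
    ; isCommutativeRing = record
      { isRing = record
        { +-isAbelianGroup = record
          { isGroup = record
            { isMonoid = record
              { isSemigroup = record
                { isMagma = record { isEquivalence = ≈ₚ-isEquivalence ; ∙-cong = ⊕-cong }
                ; assoc = ⊕-assoc
                }
              ; identity = (λ _ → ≈ₚ-refl) , ⊕-identityʳ
              }
            ; inverse = ⊕-inverseˡ , ⊕-inverseʳ
            ; ⁻¹-cong = ⊖-cong
            }
          ; comm = ⊕-comm
          }
        ; *-cong = λ {p} {p′} {q} p≈p′ q≈q′ → ≈ₚ-trans (⊗-congˡ q p≈p′) (⊗-congʳ p′ q≈q′)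
        ; *-assoc = ⊗-assoc
        ; *-identity = ⊗-identityˡ , ⊗-identityʳ
        ; distrib = ⊗-distribˡ , ⊗-distribʳ
        }
      ; *-comm = ⊗-comm
      }
    }

Alternating : ∀ {c ℓ} (K : CommutativeRing c ℓ) {n} → Matrix K n → Set ℓ
Alternating K M = Symmetric K M × (∀ i → M i i ≈ 0#)
  where open CommutativeRing K

module MatrixAlgebra {c ℓ : Level} (K : CommutativeRing c ℓ) where
  open CommutativeRing K hiding (zero)
  open RawOps _+_ _*_ -_ 0# 1# using (sumFin; signed; det)
  open import Algebra.Properties.Ring ring using (+-inverseʳ-unique)
  open import Algebra.Properties.Semiring.Sum semiring
    using (sum; sum-syntax; sum-cong-≋; sum-replicate-zero; ∑-distrib-+; ∑-comm; *-distribˡ-sum; *-distribʳ-sum)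
  open CommutativeSemigroupProperties *-commutativeSemigroup using (x∙yz≈y∙xz; xy∙z≈zy∙x)
  open SetoidReasoning setoid

  sumFin≡sum : ∀ {n} (f : Fin n → Carrier) → sumFin f ≡.≡ sum f
  sumFin≡sum {zero}  f = ≡.refl
  sumFin≡sum {suc n} f = ≡.cong (f zero +_) (sumFin≡sum (λ i → f (suc i)))

  ∑-*-∑-comm : ∀ {m n} (a : Fin n → Carrier) (b : Fin m → Carrier) (E : Fin m → Fin n → Carrier) →
               ∑[ j < n ] (a j * ∑[ i < m ] (b i * E i j)) ≈ ∑[ i < m ] (b i * ∑[ j < n ] (a j * E i j))
  ∑-*-∑-comm {m} {n} a b E = begin
    ∑[ j < n ] (a j * ∑[ i < m ] (b i * E i j))   ≈⟨ sum-cong-≋ (λ j → *-distribˡ-sum (a j) (λ i → b i * E i j)) ⟩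
    ∑[ j < n ] ∑[ i < m ] (a j * (b i * E i j))   ≈⟨ ∑-comm (λ j i → a j * (b i * E i j)) ⟩
    ∑[ i < m ] ∑[ j < n ] (a j * (b i * E i j))   ≈⟨ sum-cong-≋ (λ i → sum-cong-≋ λ j → x∙yz≈y∙xz (a j) (b i) (E i j)) ⟩
    ∑[ i < m ] ∑[ j < n ] (b i * (a j * E i j))   ≈⟨ sum-cong-≋ (λ i → *-distribˡ-sum (b i) (λ j → a j * E i j)) ⟨
    ∑[ i < m ] (b i * ∑[ j < n ] (a j * E i j))   ∎

  ∑-*-congˡ : ∀ {n} (a : Fin n → Carrier) {f g : Fin n → Carrier} → (∀ i → f i ≈ g i) →
              ∑[ i < n ] (a i * f i) ≈ ∑[ i < n ] (a i * g i)
  ∑-*-congˡ a f≈g = sum-cong-≋ λ i → *-congˡ (f≈g i)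

  minor : ∀ {n} → Matrix K (suc n) → Fin (suc n) → Fin (suc n) → Matrix K n
  minor M i j r s = M (punchIn i r) (punchIn j s)

  minor-symmetric : ∀ {n} {M : Matrix K (suc n)} → Symmetric K M → ∀ i → Symmetric K (minor M i i)
  minor-symmetric M-sym i r s = M-sym (punchIn i r) (punchIn i s)

  alternating-resp : ∀ {n} {M N : Matrix K n} → _≈ₘ_ K M N → Alternating K N → Alternating K M
  alternating-resp M≈N (N-sym , N-diag) =
    (λ i j → trans (M≈N i j) (trans (N-sym i j) (sym (M≈N j i)))) , λ i → trans (M≈N i i) (N-diag i)

  antiDiag-alternating : ∀ {n} → 2 ∣ n → Alternating K (antiDiag K {n})
  antiDiag-alternating 2∣n = symmetric , diagonal 2∣n
    where
    symmetric : ∀ {n} → Symmetric K (antiDiag K {n})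
    symmetric i j rewrite ℕ.+-comm (toℕ i) (toℕ j) = refl
    diagonal : ∀ {n} → 2 ∣ n → (i : Fin n) → antiDiag K i i ≈ 0#
    diagonal {suc m} 2∣n i with toℕ i +ℕ toℕ i ≟ m
    ... | yes i+i≡m = contradiction (≡.subst (2 ∣_) (≡.cong suc (≡.sym i+i≡m)) 2∣n) (2∤1+n+n (toℕ i))
    ... | no  _     = refl

  congruence : ∀ {n} → Matrix K n → Matrix K n → Matrix K n
  congruence P S = _⊠_ K (_⊠_ K (transpose K P) S) P

  congruence-entry : ∀ {n} (P S : Matrix K n) i j →
    congruence P S i j ≈ ∑[ k < n ] ∑[ l < n ] ((P l i * S l k) * P k j)
  congruence-entry {n} P S i j = begin
    sumFin (λ k → sumFin (λ l → P l i * S l k) * P k j)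
      ≡⟨ sumFin≡sum (λ k → sumFin (λ l → P l i * S l k) * P k j) ⟩
    ∑[ k < n ] (sumFin (λ l → P l i * S l k) * P k j)
      ≈⟨ sum-cong-≋ (λ k → *-congʳ (reflexive (sumFin≡sum (λ l → P l i * S l k)))) ⟩
    ∑[ k < n ] (∑[ l < n ] (P l i * S l k) * P k j)
      ≈⟨ sum-cong-≋ (λ k → *-distribʳ-sum (P k j) (λ l → P l i * S l k)) ⟩
    ∑[ k < n ] ∑[ l < n ] ((P l i * S l k) * P k j)
      ∎

  congruence-term-swap : ∀ {n} (P : Matrix K n) {S : Matrix K n} → Symmetric K S →
                         ∀ i j k l → (P l i * S l k) * P k j ≈ (P k j * S k l) * P l i
  congruence-term-swap P {S} S-sym i j k l =
    trans (xy∙z≈zy∙x (P l i) (S l k) (P k j)) (*-congʳ (*-congˡ (S-sym l k)))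

  congruence-symmetric : ∀ {n} (P : Matrix K n) {S : Matrix K n} → Symmetric K S →
                         Symmetric K (congruence P S)
  congruence-symmetric {n} P {S} S-sym i j = begin
    congruence P S i j
      ≈⟨ congruence-entry P S i j ⟩
    ∑[ k < n ] ∑[ l < n ] ((P l i * S l k) * P k j)
      ≈⟨ sum-cong-≋ (λ k → sum-cong-≋ λ l → congruence-term-swap P S-sym i j k l) ⟩
    ∑[ k < n ] ∑[ l < n ] ((P k j * S k l) * P l i)
      ≈⟨ ∑-comm (λ k l → (P k j * S k l) * P l i) ⟩
    ∑[ l < n ] ∑[ k < n ] ((P k j * S k l) * P l i)
      ≈⟨ congruence-entry P S j i ⟨
    congruence P S j i
      ∎

  module CharacteristicTwo (1+1≈0 : 1# + 1# ≈ 0#) where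

    x+x≈0 : ∀ x → x + x ≈ 0#
    x+x≈0 x = begin
      x + x             ≈⟨ +-cong (*-identityˡ x) (*-identityˡ x) ⟨
      1# * x + 1# * x   ≈⟨ distribʳ x 1# 1# ⟨
      (1# + 1#) * x     ≈⟨ *-congʳ 1+1≈0 ⟩
      0# * x            ≈⟨ zeroˡ x ⟩
      0#                ∎

    -x≈x : ∀ x → - x ≈ x
    -x≈x x = sym (+-inverseʳ-unique x x (x+x≈0 x))

    x+[x+y]≈y : ∀ x y → x + (x + y) ≈ y
    x+[x+y]≈y x y = begin
      x + (x + y)   ≈⟨ +-assoc x x y ⟨
      (x + x) + y   ≈⟨ +-congʳ (x+x≈0 x) ⟩
      0# + y        ≈⟨ +-identityˡ y ⟩
      y             ∎

    signed≈id : ∀ k x → signed k x ≈ x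
    signed≈id zero    x = refl
    signed≈id (suc k) x = trans (-x≈x (signed k x)) (signed≈id k x)

    ∑∑-symmetric≈∑-diagonal : ∀ {n} (f : Fin n → Fin n → Carrier) → (∀ i j → f i j ≈ f j i) →
                              ∑[ i < n ] ∑[ j < n ] f i j ≈ ∑[ i < n ] f i i
    ∑∑-symmetric≈∑-diagonal {zero}  f f-sym = refl
    ∑∑-symmetric≈∑-diagonal {suc n} f f-sym = begin
      (f zero zero + row) + ∑[ i < n ] (f (suc i) zero + ∑[ j < n ] f (suc i) (suc j))
        ≈⟨ +-congˡ (∑-distrib-+ (λ i → f (suc i) zero) (λ i → ∑[ j < n ] f (suc i) (suc j))) ⟩
      (f zero zero + row) + (column + rest)   ≈⟨ +-congˡ (+-congʳ column≈row) ⟩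
      (f zero zero + row) + (row + rest)      ≈⟨ +-assoc (f zero zero) row (row + rest) ⟩
      f zero zero + (row + (row + rest))      ≈⟨ +-congˡ (x+[x+y]≈y row rest) ⟩
      f zero zero + rest
        ≈⟨ +-congˡ (∑∑-symmetric≈∑-diagonal (λ i j → f (suc i) (suc j)) (λ i j → f-sym (suc i) (suc j))) ⟩
      f zero zero + ∑[ i < n ] f (suc i) (suc i) ∎
      where
      row column rest : Carrier
      row    = ∑[ j < n ] f zero (suc j)
      column = ∑[ i < n ] f (suc i) zero
      rest   = ∑[ i < n ] ∑[ j < n ] f (suc i) (suc j)
      column≈row : column ≈ row
      column≈row = sum-cong-≋ (λ i → f-sym (suc i) zero)

    congruence-alternating : ∀ {n} (P : Matrix K n) {S : Matrix K n} → Alternating K S →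
                             Alternating K (congruence P S)
    congruence-alternating {n} P {S} (S-sym , S-diag) = congruence-symmetric P S-sym , diagonal
      where
      diagonal : ∀ i → congruence P S i i ≈ 0#
      diagonal i = begin
        congruence P S i i                                ≈⟨ congruence-entry P S i i ⟩
        ∑[ k < n ] ∑[ l < n ] ((P l i * S l k) * P k i)   ≈⟨ ∑∑-symmetric≈∑-diagonal _ (congruence-term-swap P S-sym i i) ⟩
        ∑[ k < n ] ((P k i * S k k) * P k i)              ≈⟨ sum-cong-≋ vanish ⟩
        ∑[ k < n ] 0#                                     ≈⟨ sum-replicate-zero n ⟩
        0#                                                ∎
        where
        vanish : ∀ k → (P k i * S k k) * P k i ≈ 0#
        vanish k = trans (*-congʳ (trans (*-congˡ (S-diag k)) (zeroʳ _))) (zeroˡ _)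

    det-expandRow : ∀ {n} (M : Matrix K (suc n)) → det M ≈ ∑[ j < suc n ] (M zero j * det (minor M zero j))
    det-expandRow {n} M = trans (reflexive (sumFin≡sum (λ j → signed (toℕ j) (M zero j * det (minor M zero j)))))
                            (sum-cong-≋ {suc n} λ j → signed≈id (toℕ j) (M zero j * det (minor M zero j)))

    det-cong : ∀ {n} {M N : Matrix K n} → _≈ₘ_ K M N → det M ≈ det N
    det-cong {zero}          _   = refl
    det-cong {suc n} {M} {N} M≈N = begin
      det M                                              ≈⟨ det-expandRow M ⟩
      ∑[ j < suc n ] (M zero j * det (minor M zero j))
        ≈⟨ sum-cong-≋ {suc n} (λ j → *-cong (M≈N zero j) (det-cong λ r s → M≈N (suc r) (punchIn j s))) ⟩
      ∑[ j < suc n ] (N zero j * det (minor N zero j))   ≈⟨ det-expandRow N ⟨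
      det N                                              ∎

    det-expandCol : ∀ {n} (M : Matrix K (suc n)) → det M ≈ ∑[ i < suc n ] (M i zero * det (minor M i zero))
    det-expandCol {zero}  M = refl
    det-expandCol {suc n} M = begin
      det M
        ≈⟨ det-expandRow M ⟩
      M zero zero * det (minor M zero zero) + ∑[ j < suc n ] (M zero (suc j) * det (minor M zero (suc j)))
        ≈⟨ +-congˡ (∑-*-congˡ (λ j → M zero (suc j)) λ j → det-expandCol (minor M zero (suc j))) ⟩
      M zero zero * det (minor M zero zero) + ∑[ j < suc n ] (M zero (suc j) * ∑[ i < suc n ] (M (suc i) zero * E i j))
        ≈⟨ +-congˡ (∑-*-∑-comm (λ j → M zero (suc j)) (λ i → M (suc i) zero) E) ⟩
      M zero zero * det (minor M zero zero) + ∑[ i < suc n ] (M (suc i) zero * ∑[ j < suc n ] (M zero (suc j) * E i j))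
        ≈⟨ +-congˡ (∑-*-congˡ (λ i → M (suc i) zero) λ i → det-expandRow (minor M (suc i) zero)) ⟨
      M zero zero * det (minor M zero zero) + ∑[ i < suc n ] (M (suc i) zero * det (minor M (suc i) zero))
        ∎
      where
      E : Fin (suc n) → Fin (suc n) → Carrier
      E i j = det (minor (minor M zero zero) i j)

    det-transpose : ∀ {n} (M : Matrix K n) → det (transpose K M) ≈ det M
    det-transpose {zero}  M = refl
    det-transpose {suc n} M = begin
      det (transpose K M)                                  ≈⟨ det-expandRow (transpose K M) ⟩
      ∑[ j < suc n ] (M j zero * det (minor (transpose K M) zero j))
        ≈⟨ ∑-*-congˡ (λ j → M j zero) (λ j → det-transpose (minor M j zero)) ⟩
      ∑[ j < suc n ] (M j zero * det (minor M j zero))     ≈⟨ det-expandCol M ⟨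
      det M                                                ∎

    det-minor-comm : ∀ {n} {M : Matrix K (suc n)} → Symmetric K M → ∀ i j → det (minor M i j) ≈ det (minor M j i)
    det-minor-comm {M = M} M-sym i j =
      trans (det-cong λ r s → M-sym (punchIn i r) (punchIn j s)) (det-transpose (minor M j i))

    det-symmetric-expansion : ∀ {n} (M : Matrix K (suc (suc n))) → Symmetric K M →
      det M ≈ M zero zero * det (minor M zero zero)
              + ∑[ i < suc n ] ((M zero (suc i) * M zero (suc i)) * det (minor (minor M zero zero) i i))
    det-symmetric-expansion {n} M M-sym = begin
      det M
        ≈⟨ det-expandRow M ⟩
      M zero zero * det (minor M zero zero) + ∑[ j < suc n ] (M zero (suc j) * det (minor M zero (suc j)))
        ≈⟨ +-congˡ (∑-*-congˡ (λ j → M zero (suc j)) λ j → det-expandCol (minor M zero (suc j))) ⟩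
      M zero zero * det (minor M zero zero) + ∑[ j < suc n ] (M zero (suc j) * ∑[ i < suc n ] (M (suc i) zero * D i j))
        ≈⟨ +-congˡ (sum-cong-≋ {suc n} λ j → *-distribˡ-sum (M zero (suc j)) (λ i → M (suc i) zero * D i j)) ⟩
      M zero zero * det (minor M zero zero) + ∑[ j < suc n ] ∑[ i < suc n ] f j i
        ≈⟨ +-congˡ (∑∑-symmetric≈∑-diagonal f f-sym) ⟩
      M zero zero * det (minor M zero zero) + ∑[ i < suc n ] f i i
        ≈⟨ +-congˡ (sum-cong-≋ {suc n} f-diagonal) ⟩
      M zero zero * det (minor M zero zero) + ∑[ i < suc n ] ((M zero (suc i) * M zero (suc i)) * D i i)
        ∎
      where
      D : Fin (suc n) → Fin (suc n) → Carrier
      D i j = det (minor (minor M zero zero) i j)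
      f : Fin (suc n) → Fin (suc n) → Carrier
      f j i = M zero (suc j) * (M (suc i) zero * D i j)
      f-sym : ∀ j i → f j i ≈ f i j
      f-sym j i = trans (x∙yz≈y∙xz (M zero (suc j)) (M (suc i) zero) (D i j))
        (*-cong (M-sym (suc i) zero)
          (*-cong (M-sym zero (suc j)) (det-minor-comm (minor-symmetric M-sym zero) i j)))
      f-diagonal : ∀ i → f i i ≈ (M zero (suc i) * M zero (suc i)) * D i i
      f-diagonal i = trans (*-congˡ (*-congʳ (M-sym (suc i) zero)))
                           (sym (*-assoc (M zero (suc i)) (M zero (suc i)) (D i i)))

    module _ {s} (S : Pred Carrier s) (S-resp : S Respects _≈_)
             (S-+ : ∀ {x y} → S x → S y → S (x + y)) (S-* : ∀ {x y} → S x → S y → S (x * y))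
             (S-square : ∀ x → S (x * x)) where

      S-0# : S 0#
      S-0# = S-resp (zeroˡ 0#) (S-square 0#)

      S-1# : S 1#
      S-1# = S-resp (*-identityˡ 1#) (S-square 1#)

      sum-closed : ∀ {n} (f : Fin n → Carrier) → (∀ i → S (f i)) → S (sum f)
      sum-closed {zero}  f _   = S-0#
      sum-closed {suc n} f f∈S = S-+ (f∈S zero) (sum-closed (λ i → f (suc i)) (λ i → f∈S (suc i)))

      det-symmetric-closed : ∀ {n} (M : Matrix K n) → Symmetric K M → (∀ i → S (M i i)) → S (det M)
      det-symmetric-closed {zero}        M _     _    = S-1#
      det-symmetric-closed {suc zero}    M _     diag = S-+ (S-* (diag zero) S-1#) S-0#
      det-symmetric-closed {suc (suc n)} M M-sym diag =
        S-resp (sym (det-symmetric-expansion M M-sym))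
          (S-+ (S-* (diag zero) (det-symmetric-closed (minor M zero zero) M₀₀-sym λ i → diag (suc i)))
               (sum-closed _ λ i → S-* (S-square (M zero (suc i)))
                  (det-symmetric-closed (minor (minor M zero zero) i i) (minor-symmetric M₀₀-sym i)
                                        λ r → diag (suc (punchIn i r)))))
        where
        M₀₀-sym : Symmetric K (minor M zero zero)
        M₀₀-sym = minor-symmetric M-sym zero

module EvenPowers {c ℓ : Level} (T : CommutativeRing c ℓ) where
  open CommutativeRing T hiding (zero)
  open Polynomials T

  InEvenPowers-resp : InEvenPowers T Respects _≈ₚ_
  InEvenPowers-resp p≈q p-even k = trans (sym (coeff-≈ p≈q _)) (p-even k)

  const-InEvenPowers : ∀ a → InEvenPowers T (a ∷ [])
  const-InEvenPowers a k = refl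

  ⊕-InEvenPowers : ∀ p q → InEvenPowers T p → InEvenPowers T q → InEvenPowers T (p ⊕ q)
  ⊕-InEvenPowers p q p-even q-even k =
    trans (coeff-⊕ p q _) (trans (+-cong (p-even k) (q-even k)) (+-identityʳ 0#))

  scale-InEvenPowers : ∀ a p → InEvenPowers T p → InEvenPowers T (scale a p)
  scale-InEvenPowers a p p-even k = trans (coeff-scale a p _) (trans (*-congˡ (p-even k)) (zeroʳ a))

  shift²-InEvenPowers : ∀ p → InEvenPowers T p → InEvenPowers T (shift (shift p))
  shift²-InEvenPowers p p-even zero    = refl
  shift²-InEvenPowers p p-even (suc k) = ≡.subst (λ m → coeff T p m ≈ 0#) (≡.sym (ℕ.+-suc k k)) (p-even k)

  tail²-InEvenPowers : ∀ a b p → InEvenPowers T (a ∷ b ∷ p) → InEvenPowers T p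
  tail²-InEvenPowers a b p p-even k = ≡.subst (λ m → coeff T p m ≈ 0#) (ℕ.+-suc k k) (p-even (suc k))

  ⊗-InEvenPowers : ∀ p q → InEvenPowers T p → InEvenPowers T q → InEvenPowers T (p ⊗ q)
  ⊗-InEvenPowers []          q _      _      _ = refl
  ⊗-InEvenPowers (a ∷ [])    q _      q-even   =
    ⊕-InEvenPowers (scale a q) (shift []) (scale-InEvenPowers a q q-even) λ _ → refl
  ⊗-InEvenPowers (a ∷ b ∷ p) q p-even q-even =
    InEvenPowers-resp (≈ₚ-sym expand)
      (⊕-InEvenPowers (scale a q) (shift (shift (p ⊗ q))) (scale-InEvenPowers a q q-even)
        (shift²-InEvenPowers (p ⊗ q) (⊗-InEvenPowers p q (tail²-InEvenPowers a b p p-even) q-even)))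
    where
    expand : (a ∷ b ∷ p) ⊗ q ≈ₚ scale a q ⊕ shift (shift (p ⊗ q))
    expand = ⊕-cong ≈ₚ-refl (shift-cong (⊕-cong b·q≈0 ≈ₚ-refl))
      where
      b·q≈0 : scale b q ≈ₚ []
      b·q≈0 = ≈ₚ-trans (scale-cong (p-even zero) ≈ₚ-refl) (scale-0# q)

  module CharacteristicTwo (1+1≈0 : 1# + 1# ≈ 0#) where

    polynomialRing-1+1≈0 : 1ₚ ⊕ 1ₚ ≈ₚ []
    polynomialRing-1+1≈0 = coeffwise λ { zero → 1+1≈0 ; (suc k) → refl }

    open MatrixAlgebra.CharacteristicTwo polynomialRing polynomialRing-1+1≈0
      using (x+[x+y]≈y; det-symmetric-closed)

    square-InEvenPowers : ∀ p → InEvenPowers T (p ⊗ p)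
    square-InEvenPowers []      _ = refl
    square-InEvenPowers (a ∷ p)   =
      InEvenPowers-resp (≈ₚ-sym expand)
        (⊕-InEvenPowers (a * a ∷ []) (shift (shift (p ⊗ p))) (const-InEvenPowers (a * a))
          (shift²-InEvenPowers (p ⊗ p) (square-InEvenPowers p)))
      where
      -- the Frobenius identity (a + x p)² = a² + x² p²
      expand : (a ∷ p) ⊗ (a ∷ p) ≈ₚ (a * a ∷ []) ⊕ shift (shift (p ⊗ p))
      expand = begin
        scale a (a ∷ p) ⊕ shift (p ⊗ (a ∷ p))
          ≈⟨ ⊕-cong (≈ₚ-refl {scale a (a ∷ p)}) (shift-cong (⊗-consʳ p a p)) ⟩
        (a * a + 0#) ∷ (scale a p ⊕ (scale a p ⊕ shift (p ⊗ p)))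
          ≈⟨ ∷-cong (+-identityʳ (a * a)) (x+[x+y]≈y (scale a p) (shift (p ⊗ p))) ⟩
        a * a ∷ shift (p ⊗ p)
          ≈⟨ ∷-split (a * a) (shift (p ⊗ p)) ⟩
        (a * a ∷ []) ⊕ shift (shift (p ⊗ p))
          ∎
        where open SetoidReasoning ≈ₚ-setoid

    resolvent-InEvenPowers : ∀ {n} {A B : Matrix T n} → Alternating T A → Symmetric T B →
                             InEvenPowers T (resolvent T A B)
    resolvent-InEvenPowers {A = A} {B} (A-sym , A-diag) B-sym =
      det-symmetric-closed (InEvenPowers T) InEvenPowers-resp (λ {p} {q} → ⊕-InEvenPowers p q)
        (λ {p} {q} → ⊗-InEvenPowers p q)
        square-InEvenPowers (λ i j → (- B i j) ∷ A i j ∷ [])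
        (λ i j → ∷-cong (-‿cong (B-sym i j)) (∷-cong (A-sym i j) ≈ₚ-refl)) diagonal
      where
      diagonal : ∀ i → InEvenPowers T ((- B i i) ∷ A i i ∷ [])
      diagonal i zero    = A-diag i
      diagonal i (suc k) = refl

mainTheorem9 : ∀ {c ℓ : Level} (T : CommutativeRing c ℓ) → Char2 T →
    (n : ℕ) → 2 ∣ n → (A B : Matrix T n) →
    Hyperbolic T A → Symmetric T B →
    InEvenPowers T (resolvent T A B)
mainTheorem9 T (1+1≈0 , _) n 2∣n A B (P , _ , A≈PᵗJP) B-sym =
  resolvent-InEvenPowers (alternating-resp A≈PᵗJP (congruence-alternating P (antiDiag-alternating 2∣n))) B-sym
  where
  open EvenPowers.CharacteristicTwo T 1+1≈0 using (resolvent-InEvenPowers)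
  open MatrixAlgebra T using (alternating-resp; antiDiag-alternating)
  open MatrixAlgebra.CharacteristicTwo T 1+1≈0 using (congruence-alternating)
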